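{- Let $m\geq 7$ be an odd integer and let $n\geq 4m$ be a sufficiently large integer. Let $G$ be a graph on $3n+4$ vertices such that $G$ contains no copy of $\mathbb{K}_{2,n}$ and $\overline{G}$ contains no copy of $W_m$. Let $v$ be a vertex of maximum degree in $\overline{G}$, and let $\overline{H}=\overline{G}[N_{\overline{G}}(v)]$ be the subgraph of $\overline{G}$ induced by the neighbourhood of $v$ in $\overline{G}$. Then \[ \left|\left\{x\in V(\overline{H}) : |N_{\overline{H}}(x)|<\frac{|V(\overline{H})|}{10}+1\right\}\right|\leq 1 . \]
   Context: All graphs are finite, simple and undirected; $\overline{G}$ is the complement of $G$, $G[S]$ denotes the subgraph induced by $S$, and $N_F(x)$ is the neighbourhood of $x$ in the graph $F$. $\mathbb{K}_{2,n}$ is the complete bipartite graph with parts of sizes $2$ and $n$; the wheel $W_m$ is the cycle $C_m$ together with a new vertex adjacent to all its vertices. -}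

module Defs where

open import Data.Nat using (ℕ; zero; suc; _+_; _*_; _<_; _≤_; _%_)
open import Data.Fin using (Fin; zero; suc; toℕ)
open import Data.Bool using (Bool; true; false; not; _∧_; _∨_; if_then_else_)
open import Data.Product using (Σ; _×_; _,_)
open import Relation.Binary.PropositionalEquality using (_≡_; refl; cong; cong₂; trans)
import Relation.Binary.PropositionalEquality as Eq
import Data.Fin as Fin
open import Data.Empty using (⊥-elim)
open import Relation.Nullary using (yes; no)
open import Function.Definitions using (Injective)
open import Relation.Nullary using (¬_)
open import Relation.Nullary.Decidable using (⌊_⌋)
open import Data.Nat.Properties using (_<?_)

record Graph (k : ℕ) : Set where
  field
    adj    : Fin k → Fin k → Bool
    sym    : ∀ i j → adj i j ≡ adj j i
    irrefl : ∀ i → adj i i ≡ false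
open Graph public

neqᶠ : ∀ {k} → Fin k → Fin k → Bool
neqᶠ i j = not ⌊ i Fin.≟ j ⌋

complement : ∀ {k} → Graph k → Graph k
complement G = record
  { adj    = λ i j → not (adj G i j) ∧ neqᶠ i j
  ; sym    = λ i j → cong₂ _∧_ (cong not (sym G i j)) (neq-sym i j)
  ; irrefl = λ i → trans (cong (not (adj G i i) ∧_) (neq-irr i)) (∧-f _) }
  where
  ∧-f : ∀ a → (a ∧ false) ≡ false
  ∧-f false = refl
  ∧-f true = refl
  neq-irr : ∀ {k} (i : Fin k) → neqᶠ i i ≡ false
  neq-irr i with i Fin.≟ i
  ... | yes _ = refl
  ... | no ¬p = ⊥-elim (¬p refl)
  neq-sym : ∀ {k} (i j : Fin k) → neqᶠ i j ≡ neqᶠ j i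
  neq-sym i j with i Fin.≟ j | j Fin.≟ i
  ... | yes _ | yes _ = refl
  ... | no _ | no _ = refl
  ... | yes p | no q = ⊥-elim (q (Eq.sym p))
  ... | no p | yes q = ⊥-elim (p (Eq.sym q))

ContainsCopy : ∀ {h k} → Graph k → Graph h → Set
ContainsCopy {h} {k} G H =
  Σ (Fin h → Fin k) λ f →
    Injective _≡_ _≡_ f × (∀ i j → adj H i j ≡ true → adj G (f i) (f j) ≡ true)

count : ∀ {k} → (Fin k → Bool) → ℕ
count {zero}  p = 0
count {suc k} p = (if p zero then 1 else 0) + count (λ i → p (suc i))

isLow : ℕ → Bool
isLow i = ⌊ i <? 2 ⌋

-- K_{2,n} on Fin (2 + n): vertices 0,1 form one part, the rest the other part.
K2 : (n : ℕ) → Graph (2 + n)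
K2 n = record
  { adj = λ i j → (isLow (toℕ i) ∧ not (isLow (toℕ j))) ∨ (isLow (toℕ j) ∧ not (isLow (toℕ i)))
  ; sym = λ i j → symLemma (isLow (toℕ i)) (isLow (toℕ j))
  ; irrefl = λ i → irr (isLow (toℕ i)) }
  where
  symLemma : ∀ a b → ((a ∧ not b) ∨ (b ∧ not a)) ≡ ((b ∧ not a) ∨ (a ∧ not b))
  symLemma false false = refl
  symLemma false true  = refl
  symLemma true  false = refl
  symLemma true  true  = refl
  irr : ∀ a → ((a ∧ not a) ∨ (a ∧ not a)) ≡ false
  irr false = refl
  irr true  = refl

_≡ᵇ_ : ℕ → ℕ → Bool
zero  ≡ᵇ zero  = true
zero  ≡ᵇ suc _ = false
suc _ ≡ᵇ zero  = false
suc a ≡ᵇ suc b = a ≡ᵇ b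

cycAdj : (m : ℕ) → ℕ → ℕ → Bool
cycAdj zero    i j = false
cycAdj (suc m) i j = ((j ≡ᵇ ((suc i) % suc m)) ∨ (i ≡ᵇ ((suc j) % suc m))) ∧ not (i ≡ᵇ j)

-- wheel adjacency on Fin (suc m): vertex 0 is the hub, vertices 1..m form the cycle C_m
wAdj : (m : ℕ) → ∀ {k} → Fin k → Fin k → Bool
wAdj m zero    zero    = false
wAdj m zero    (suc _) = true
wAdj m (suc _) zero    = true
wAdj m (suc i) (suc j) = cycAdj m (toℕ i) (toℕ j)

private
  ≡ᵇ-sym : ∀ a b → (a ≡ᵇ b) ≡ (b ≡ᵇ a)
  ≡ᵇ-sym zero zero = refl
  ≡ᵇ-sym zero (suc b) = refl
  ≡ᵇ-sym (suc a) zero = refl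
  ≡ᵇ-sym (suc a) (suc b) = ≡ᵇ-sym a b
  ≡ᵇ-refl : ∀ a → (a ≡ᵇ a) ≡ true
  ≡ᵇ-refl zero = refl
  ≡ᵇ-refl (suc a) = ≡ᵇ-refl a
  ∨-comm : ∀ a b → (a ∨ b) ≡ (b ∨ a)
  ∨-comm false false = refl
  ∨-comm false true = refl
  ∨-comm true false = refl
  ∨-comm true true = refl
  ∧-false : ∀ a → (a ∧ false) ≡ false
  ∧-false false = refl
  ∧-false true = refl

cycAdj-sym : ∀ m i j → cycAdj m i j ≡ cycAdj m j i
cycAdj-sym zero i j = refl
cycAdj-sym (suc m) i j
  rewrite ∨-comm (j ≡ᵇ ((suc i) % suc m)) (i ≡ᵇ ((suc j) % suc m)) | ≡ᵇ-sym i j = refl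

cycAdj-irr : ∀ m i → cycAdj m i i ≡ false
cycAdj-irr zero i = refl
cycAdj-irr (suc m) i rewrite ≡ᵇ-refl i = ∧-false _

Wheel : (m : ℕ) → Graph (suc m)
Wheel m = record { adj = wAdj m ; sym = s ; irrefl = r }
  where
  s : ∀ i j → wAdj m i j ≡ wAdj m j i
  s zero zero = refl
  s zero (suc j) = refl
  s (suc i) zero = refl
  s (suc i) (suc j) = cycAdj-sym m (toℕ i) (toℕ j)
  r : ∀ i → wAdj m i i ≡ false
  r zero = refl
  r (suc i) = cycAdj-irr m (toℕ i)

degree : ∀ {k} → Graph k → Fin k → ℕ
degree F x = count (λ y → adj F x y)

-- degree of x (a vertex of N_F(v)) inside the induced subgraph F[N_F(v)]
degreeInNbhd : ∀ {k} → Graph k → Fin k → Fin k → ℕ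
degreeInNbhd F v x = count (λ y → adj F v y ∧ adj F x y)

-- |{x ∈ V(H̄) : |N_H̄(x)| < |V(H̄)|/10 + 1}| where H̄ = F[N_F(v)];
-- the inequality d < D/10 + 1 is written as 10 d < D + 10.
lowDegreeCount : ∀ {k} → Graph k → Fin k → ℕ
lowDegreeCount F v =
  count (λ x → adj F v x ∧ ⌊ 10 * degreeInNbhd F v x <? degree F v + 10 ⌋)

{-# OPTIONS --safe #-}
module Submission where

-- Let D be the maximum degree of Ḡ and suppose x ≠ y both have degree < D/10 + 1 in H̄. Every
-- Ḡ-neighbour of v other than x and y is either a common G-neighbour of x and y (there are fewer
-- than n of those) or an H̄-neighbour of x or of y, which gives 4D ≤ 5n + 14. Hence every vertex
-- has G-degree at least δ = 3n + 3 − D ≥ (7n − 2)/4. Now count the walks v–a–w of length two in G: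
-- there are at least δ², and at most (3n + 4)(n + 1) because v and any w ≠ v have fewer than n
-- common neighbours. So 49n² ≤ (4δ + 2)² ≤ 48n² + 160n + 132, which is impossible for n ≥ 161.

open import Defs
open import Data.Nat using (ℕ; zero; suc; _+_; _*_; _∸_; _≤_; _<_; z≤n; s≤s; s≤s⁻¹)
open import Data.Nat.Properties
  using (≤-refl; ≤-trans; ≤-reflexive; <⇒≤; ≰⇒>; m≤n⇒m≤1+n; n≤1+n; _≤?_; _<?_; +-comm; +-suc;
         +-mono-≤; +-monoˡ-≤; +-monoʳ-≤; *-mono-≤; *-monoˡ-≤; *-monoʳ-≤; +-cancelˡ-≤; *-cancelˡ-≤;
         m∸n≤m; m≤n+m∸n; m≤n+o⇒m∸n≤o; +-0-commutativeMonoid; module ≤-Reasoning)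
open import Data.Nat.Tactic.RingSolver using (solve)
open import Data.Fin using (Fin; zero; suc; punchIn; _≟_)
open import Data.Fin.Properties using (suc-injective; punchInᵢ≢i)
import Data.Vec.Functional as Vector
open import Data.Bool using (Bool; true; false; not; _∧_; _∨_; if_then_else_)
open import Data.Product using (Σ; Σ-syntax; _×_; _,_; proj₁; proj₂)
open import Data.List using (_∷_; [])
open import Data.Empty using (⊥; ⊥-elim)
open import Function.Base using (_∘_)
open import Function.Definitions using (Injective)
open import Relation.Nullary using (¬_; Dec; yes; no)
open import Relation.Nullary.Decidable using (⌊_⌋; decidable-stable; from-no)
open import Relation.Binary.PropositionalEquality using (_≡_; _≢_; refl; cong; cong₂)
import Relation.Binary.PropositionalEquality as ≡
open import Algebra.Properties.CommutativeMonoid.Sum +-0-commutativeMonoid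
  using (sum; sum-cong-≗; sum-remove; ∑-comm)

∧≡true : ∀ {a b} → (a ∧ b) ≡ true → a ≡ true × b ≡ true
∧≡true {true} {true} refl = refl , refl

⌊⌋≡true⇒ : ∀ {A : Set} {d : Dec A} → ⌊ d ⌋ ≡ true → A
⌊⌋≡true⇒ {d = yes a} _ = a

∷-injective : ∀ {m k} {x : Fin k} {f : Fin m → Fin k} →
  (∀ i → f i ≢ x) → Injective _≡_ _≡_ f → Injective _≡_ _≡_ (x Vector.∷ f)
∷-injective f≢x f-inj {zero}  {zero}  _ = refl
∷-injective f≢x f-inj {zero}  {suc j} e = ⊥-elim (f≢x j (≡.sym e))
∷-injective f≢x f-inj {suc i} {zero}  e = ⊥-elim (f≢x i e)
∷-injective f≢x f-inj {suc i} {suc j} e = cong suc (f-inj e)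

count-≤ : ∀ {k} (p : Fin k → Bool) → count p ≤ k
count-≤ {zero}  p = z≤n
count-≤ {suc k} p with p zero
... | true  = s≤s (count-≤ (p ∘ suc))
... | false = m≤n⇒m≤1+n (count-≤ (p ∘ suc))

count-true : ∀ {k} → count {k} (λ _ → true) ≡ k
count-true {zero}  = refl
count-true {suc k} = cong suc (count-true {k})

count-false : ∀ {k} → count {k} (λ _ → false) ≡ 0
count-false {zero}  = refl
count-false {suc k} = count-false {k}

count-cong : ∀ {k} {p q : Fin k → Bool} → (∀ i → p i ≡ q i) → count p ≡ count q
count-cong {zero}  p≗q = refl
count-cong {suc k} p≗q =
  cong₂ _+_ (cong (λ b → if b then 1 else 0) (p≗q zero)) (count-cong (p≗q ∘ suc))

count-mono : ∀ {k} {p q : Fin k → Bool} → (∀ i → p i ≡ true → q i ≡ true) →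
  count p ≤ count q
count-mono {zero} p⇒q = z≤n
count-mono {suc k} {p} {q} p⇒q with p zero in p₀ | q zero in q₀
... | true  | true  = s≤s (count-mono (p⇒q ∘ suc))
... | true  | false with () ← ≡.trans (≡.sym (p⇒q zero p₀)) q₀
... | false | true  = m≤n⇒m≤1+n (count-mono (p⇒q ∘ suc))
... | false | false = count-mono (p⇒q ∘ suc)

count-∨ : ∀ {k} (p q : Fin k → Bool) → count (λ i → p i ∨ q i) ≤ count p + count q
count-∨ {zero}  p q = z≤n
count-∨ {suc k} p q with p zero | q zero
... | true  | true  =
  s≤s (≤-trans (count-∨ (p ∘ suc) (q ∘ suc)) (+-monoʳ-≤ (count (p ∘ suc)) (n≤1+n _)))
... | true  | false = s≤s (count-∨ (p ∘ suc) (q ∘ suc))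
... | false | true  =
  ≤-trans (s≤s (count-∨ (p ∘ suc) (q ∘ suc))) (≤-reflexive (≡.sym (+-suc _ _)))
... | false | false = count-∨ (p ∘ suc) (q ∘ suc)

count-∨-≤ : ∀ {k} {p q : Fin k → Bool} {a b} → count p ≤ a → count q ≤ b →
  count (λ i → p i ∨ q i) ≤ a + b
count-∨-≤ {p = p} {q} p≤a q≤b = ≤-trans (count-∨ p q) (+-mono-≤ p≤a q≤b)

count-∧ : ∀ {k} b (q : Fin k → Bool) → count (λ i → b ∧ q i) ≡ (if b then count q else 0)
count-∧     true  q = refl
count-∧ {k} false q = count-false {k}

count-injection : ∀ {k} (p : Fin k → Bool) {m} → m ≤ count p →
  Σ[ f ∈ (Fin m → Fin k) ] Injective _≡_ _≡_ f × (∀ i → p (f i) ≡ true)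
count-injection p {zero} _ = (λ ()) , (λ { {()} }) , (λ ())
count-injection {suc k} p {suc m} m<count with p zero in p₀
... | true =
  let f , f-inj , pf = count-injection (p ∘ suc) (s≤s⁻¹ m<count)
  in  zero Vector.∷ (suc ∘ f) , ∷-injective (λ _ ()) (f-inj ∘ suc-injective) ,
      λ { zero → p₀ ; (suc i) → pf i }
... | false =
  let f , f-inj , pf = count-injection (p ∘ suc) m<count
  in  suc ∘ f , f-inj ∘ suc-injective , pf

count≤1 : ∀ {k} (p : Fin k → Bool) → (∀ i j → p i ≡ true → p j ≡ true → i ≡ j) →
  count p ≤ 1
count≤1 p unique with 2 ≤? count p
... | no  count≱2 = s≤s⁻¹ (≰⇒> count≱2)
... | yes count≥2 with f , f-inj , pf ← count-injection p count≥2
                  with () ← f-inj (unique (f zero) (f (suc zero)) (pf zero) (pf (suc zero)))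

count-≟≤1 : ∀ {k} (x : Fin k) → count (λ j → ⌊ x ≟ j ⌋) ≤ 1
count-≟≤1 x = count≤1 (λ j → ⌊ x ≟ j ⌋) λ i j x≡i x≡j → ≡.trans (≡.sym (⌊⌋≡true⇒ x≡i)) (⌊⌋≡true⇒ x≡j)

count≡∑ : ∀ {k} (p : Fin k → Bool) → count p ≡ sum (λ i → if p i then 1 else 0)
count≡∑ {zero}  p = refl
count≡∑ {suc k} p = cong ((if p zero then 1 else 0) +_) (count≡∑ (p ∘ suc))

count*≤∑ : ∀ {k} (p : Fin k → Bool) (f : Fin k → ℕ) {δ} →
  (∀ a → p a ≡ true → δ ≤ f a) → count p * δ ≤ sum (λ a → if p a then f a else 0)
count*≤∑ {zero}  p f _ = z≤n
count*≤∑ {suc k} p f δ≤f with p zero in p₀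
... | true  = +-mono-≤ (δ≤f zero p₀) (count*≤∑ (p ∘ suc) (f ∘ suc) (δ≤f ∘ suc))
... | false = count*≤∑ (p ∘ suc) (f ∘ suc) (δ≤f ∘ suc)

∑-≤ : ∀ {k} {f : Fin k → ℕ} {c} → (∀ i → f i ≤ c) → sum f ≤ k * c
∑-≤ {zero}  _   = z≤n
∑-≤ {suc k} f≤c = +-mono-≤ (f≤c zero) (∑-≤ (f≤c ∘ suc))

∑-≤-except : ∀ {k} (f : Fin k → ℕ) (v : Fin k) {c} → (∀ w → w ≢ v → f w ≤ c) →
  sum f ≤ f v + k * c
∑-≤-except {suc k} f v {c} f≤c = begin
  sum f                      ≡⟨ sum-remove {i = v} f ⟩
  f v + sum (f ∘ punchIn v)  ≤⟨ +-monoʳ-≤ (f v) (∑-≤ (f≤c _ ∘ punchInᵢ≢i v)) ⟩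
  f v + k * c                ≤⟨ +-monoʳ-≤ (f v) (*-monoˡ-≤ c (n≤1+n k)) ⟩
  f v + suc k * c            ∎
  where open ≤-Reasoning

adj⇒≢ : ∀ {k} (F : Graph k) {x y} → adj F x y ≡ true → y ≢ x
adj⇒≢ F {x} x~x refl with () ← ≡.trans (≡.sym x~x) (irrefl F x)

codegree : ∀ {k} → Graph k → Fin k → Fin k → ℕ
codegree F a b = count (λ w → adj F a w ∧ adj F b w)

walks₂ : ∀ {k} → Graph k → Fin k → ℕ
walks₂ F v = sum (λ a → count (λ w → adj F v a ∧ adj F a w))

walks₂≡∑codegree : ∀ {k} (F : Graph k) v → walks₂ F v ≡ sum (codegree F v)
walks₂≡∑codegree {k} F v = begin
  sum (λ a → count (λ w → walk a w))
    ≡⟨ sum-cong-≗ (λ a → count≡∑ (walk a)) ⟩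
  sum (λ a → sum (λ w → 𝟙 (walk a w)))
    ≡⟨ ∑-comm (λ a w → 𝟙 (walk a w)) ⟩
  sum (λ w → sum (λ a → 𝟙 (walk a w)))
    ≡⟨ sum-cong-≗ (λ w → ≡.sym (count≡∑ (λ a → walk a w))) ⟩
  sum (λ w → count (λ a → walk a w))
    ≡⟨ sum-cong-≗ (λ w → count-cong (λ a → cong (adj F v a ∧_) (sym F a w))) ⟩
  sum (codegree F v)
    ∎
  where
  open ≡.≡-Reasoning
  walk : Fin k → Fin k → Bool
  walk a w = adj F v a ∧ adj F a w
  𝟙 : Bool → ℕ
  𝟙 b = if b then 1 else 0

δ*δ≤walks₂ : ∀ {k} (F : Graph k) v {δ} → (∀ a → δ ≤ degree F a) → δ * δ ≤ walks₂ F v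
δ*δ≤walks₂ F v {δ} δ≤degree = begin
  δ * δ
    ≤⟨ *-monoˡ-≤ δ (δ≤degree v) ⟩
  degree F v * δ
    ≤⟨ count*≤∑ (adj F v) (degree F) (λ a _ → δ≤degree a) ⟩
  sum (λ a → if adj F v a then degree F a else 0)
    ≡⟨ sum-cong-≗ (λ a → ≡.sym (count-∧ (adj F v a) (adj F a))) ⟩
  walks₂ F v
    ∎
  where open ≤-Reasoning

walks₂≤ : ∀ {k} (F : Graph k) v {c} → (∀ w → w ≢ v → codegree F v w ≤ c) →
  walks₂ F v ≤ k + k * c
walks₂≤ {k} F v {c} codegree≤c = begin
  walks₂ F v                  ≡⟨ walks₂≡∑codegree F v ⟩
  sum (codegree F v)          ≤⟨ ∑-≤-except (codegree F v) v codegree≤c ⟩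
  codegree F v v + k * c      ≤⟨ +-monoˡ-≤ (k * c) (count-≤ _) ⟩
  k + k * c                   ∎
  where open ≤-Reasoning

degree+degree-complement : ∀ {k} (G : Graph k) a → k ≤ 1 + (degree G a + degree (complement G) a)
degree+degree-complement {k} G a = begin
  k
    ≡⟨ ≡.sym (count-true {k}) ⟩
  count {k} (λ _ → true)
    ≤⟨ count-mono (λ j _ → trichotomy ⌊ a ≟ j ⌋ (adj G a j)) ⟩
  count (λ j → ⌊ a ≟ j ⌋ ∨ adj G a j ∨ adj (complement G) a j)
    ≤⟨ count-∨-≤ {k} (count-≟≤1 a) (count-∨ (adj G a) _) ⟩
  1 + (degree G a + degree (complement G) a)
    ∎
  where
  open ≤-Reasoning
  trichotomy : ∀ e b → (e ∨ b ∨ (not b ∧ not e)) ≡ true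
  trichotomy true  _     = refl
  trichotomy false true  = refl
  trichotomy false false = refl

complement-maxDegree⇒minDegree : ∀ {k} (G : Graph k) {D} → (∀ u → degree (complement G) u ≤ D) →
  ∀ a → k ∸ suc D ≤ degree G a
complement-maxDegree⇒minDegree {k} G {D} maxDegree a = m≤n+o⇒m∸n≤o k (suc D) (begin
  k                                           ≤⟨ degree+degree-complement G a ⟩
  1 + (degree G a + degree (complement G) a)  ≤⟨ s≤s (+-monoʳ-≤ (degree G a) (maxDegree a)) ⟩
  1 + (degree G a + D)                        ≡⟨ cong suc (+-comm (degree G a) D) ⟩
  suc D + degree G a                          ∎)
  where open ≤-Reasoning

K2-copy : ∀ {k n} (G : Graph k) {a b} → a ≢ b →
  (f : Fin n → Fin k) → Injective _≡_ _≡_ f → (∀ i → (adj G a (f i) ∧ adj G b (f i)) ≡ true) →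
  ContainsCopy G (K2 n)
K2-copy G {a} {b} a≢b f f-inj common =
  a Vector.∷ b Vector.∷ f , ∷-injective ≢a (∷-injective ≢b f-inj) , edge
  where
  a~ : ∀ i → adj G a (f i) ≡ true
  a~ = proj₁ ∘ ∧≡true ∘ common
  b~ : ∀ i → adj G b (f i) ≡ true
  b~ = proj₂ ∘ ∧≡true ∘ common
  ≢a : ∀ i → (b Vector.∷ f) i ≢ a
  ≢a zero    = a≢b ∘ ≡.sym
  ≢a (suc i) = adj⇒≢ G (a~ i)
  ≢b : ∀ i → f i ≢ b
  ≢b i = adj⇒≢ G (b~ i)
  edge : ∀ i j → adj (K2 _) i j ≡ true →
    adj G ((a Vector.∷ b Vector.∷ f) i) ((a Vector.∷ b Vector.∷ f) j) ≡ true
  edge zero          (suc (suc j)) _ = a~ j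
  edge (suc zero)    (suc (suc j)) _ = b~ j
  edge (suc (suc i)) zero          _ = ≡.trans (sym G (f i) a) (a~ i)
  edge (suc (suc i)) (suc zero)    _ = ≡.trans (sym G (f i) b) (b~ i)
  edge zero          zero          ()
  edge zero          (suc zero)    ()
  edge (suc zero)    zero          ()
  edge (suc zero)    (suc zero)    ()
  edge (suc (suc i)) (suc (suc j)) ()

K2-free⇒codegree< : ∀ {k n} (G : Graph k) → ¬ ContainsCopy G (K2 n) →
  ∀ {a b} → a ≢ b → codegree G a b < n
K2-free⇒codegree< {n = n} G K2-free {a} {b} a≢b with n ≤? codegree G a b
... | no  n≰codegree = ≰⇒> n≰codegree
... | yes n≤codegree with f , f-inj , common ← count-injection _ n≤codegree =
  ⊥-elim (K2-free (K2-copy G a≢b f f-inj common))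

lowInNbhd : ∀ {k} → Graph k → Fin k → Fin k → Bool
lowInNbhd F v x = adj F v x ∧ ⌊ 10 * degreeInNbhd F v x <? degree F v + 10 ⌋

degree-complement≤codegree+degreesInNbhd : ∀ {k} (G : Graph k) v x y →
  degree (complement G) v ≤
    1 + (1 + (codegree G x y + (degreeInNbhd (complement G) v x + degreeInNbhd (complement G) v y)))
degree-complement≤codegree+degreesInNbhd {k} G v x y = begin
  degree Ḡ v
    ≤⟨ count-mono covered ⟩
  count (λ w → ⌊ x ≟ w ⌋ ∨ ⌊ y ≟ w ⌋ ∨ (adj G x w ∧ adj G y w) ∨ inNbhd x w ∨ inNbhd y w)
    ≤⟨ count-∨-≤ {k} (count-≟≤1 x)
         (count-∨-≤ {k} (count-≟≤1 y) (count-∨-≤ {k} ≤-refl (count-∨ {k} _ _))) ⟩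
  1 + (1 + (codegree G x y + (degreeInNbhd Ḡ v x + degreeInNbhd Ḡ v y)))
    ∎
  where
  open ≤-Reasoning
  Ḡ = complement G
  cover : ∀ a b c d → (c ∨ d ∨ (a ∧ b) ∨ (not a ∧ not c) ∨ (not b ∧ not d)) ≡ true
  cover _     _     true  _     = refl
  cover _     _     false true  = refl
  cover false _     false false = refl
  cover true  true  false false = refl
  cover true  false false false = refl
  inNbhd : Fin k → Fin k → Bool
  inNbhd z w = adj Ḡ v w ∧ adj Ḡ z w
  covered : ∀ w → adj Ḡ v w ≡ true →
    (⌊ x ≟ w ⌋ ∨ ⌊ y ≟ w ⌋ ∨ (adj G x w ∧ adj G y w) ∨ inNbhd x w ∨ inNbhd y w) ≡ true
  -- once adj Ḡ v w is true, inNbhd z w unfolds to not (adj G z w) ∧ not ⌊ z ≟ w ⌋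
  covered w v~w rewrite v~w = cover (adj G x w) (adj G y w) ⌊ x ≟ w ⌋ ⌊ y ≟ w ⌋

4D≤5n+14 : ∀ n D c dx dy → D ≤ 1 + (1 + (c + (dx + dy))) → c < n →
  10 * dx < D + 10 → 10 * dy < D + 10 → 4 * D ≤ 5 * n + 14
4D≤5n+14 n D c dx dy D≤ c<n dx-low dy-low = *-cancelˡ-≤ 2 (+-cancelˡ-≤ (2 * D + 12) _ _ (begin
  2 * D + 12 + 2 * (4 * D)                      ≡⟨ solve (D ∷ []) ⟩
  10 * D + 12                                   ≤⟨ +-monoˡ-≤ 12 (*-monoʳ-≤ 10 D≤) ⟩
  10 * (1 + (1 + (c + (dx + dy)))) + 12         ≡⟨ solve (c ∷ dx ∷ dy ∷ []) ⟩
  10 * (1 + c) + ((1 + 10 * dx) + (1 + 10 * dy)) + 20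
    ≤⟨ +-monoˡ-≤ 20 (+-mono-≤ (*-monoʳ-≤ 10 c<n) (+-mono-≤ dx-low dy-low)) ⟩
  10 * n + ((D + 10) + (D + 10)) + 20           ≡⟨ solve (n ∷ D ∷ []) ⟩
  2 * D + 12 + 2 * (5 * n + 14)                 ∎))
  where open ≤-Reasoning

7n≤4δ+2 : ∀ n D δ → 4 * D ≤ 5 * n + 14 → 3 * n + 4 ≤ suc D + δ → 7 * n ≤ 4 * δ + 2
7n≤4δ+2 n D δ 4D≤ N≤ = +-cancelˡ-≤ (5 * n + 16) _ _ (begin
  5 * n + 16 + 7 * n            ≡⟨ solve (n ∷ []) ⟩
  4 * (3 * n + 4)               ≤⟨ *-monoʳ-≤ 4 N≤ ⟩
  4 * (1 + D + δ)               ≡⟨ solve (D ∷ δ ∷ []) ⟩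
  4 + 4 * D + 4 * δ             ≤⟨ +-monoˡ-≤ (4 * δ) (+-monoʳ-≤ 4 4D≤) ⟩
  4 + (5 * n + 14) + 4 * δ      ≡⟨ solve (n ∷ δ ∷ []) ⟩
  5 * n + 16 + (4 * δ + 2)      ∎)
  where open ≤-Reasoning

n*n≤160n+132 : ∀ n δ → 7 * n ≤ 4 * δ + 2 → δ ≤ 3 * n + 4 →
  δ * δ ≤ (3 * n + 4) + (3 * n + 4) * n → n * n ≤ 160 * n + 132
n*n≤160n+132 n δ 7n≤ δ≤N δ²≤ = +-cancelˡ-≤ (48 * (n * n)) _ _ (begin
  48 * (n * n) + n * n                                  ≡⟨ solve (n ∷ []) ⟩
  (7 * n) * (7 * n)                                     ≤⟨ *-mono-≤ 7n≤ 7n≤ ⟩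
  (4 * δ + 2) * (4 * δ + 2)                             ≡⟨ solve (δ ∷ []) ⟩
  16 * (δ * δ) + 16 * δ + 4
    ≤⟨ +-monoˡ-≤ 4 (+-mono-≤ (*-monoʳ-≤ 16 δ²≤) (*-monoʳ-≤ 16 δ≤N)) ⟩
  16 * ((3 * n + 4) + (3 * n + 4) * n) + 16 * (3 * n + 4) + 4
    ≡⟨ solve (n ∷ []) ⟩
  48 * (n * n) + (160 * n + 132)                        ∎)
  where open ≤-Reasoning

n*n≰160n+132 : ∀ {n} → 161 ≤ n → n * n ≤ 160 * n + 132 → ⊥
n*n≰160n+132 {n} 161≤n n²≤ = from-no (161 ≤? 132) (≤-trans 161≤n n≤132)
  where
  open ≤-Reasoning
  n≤132 : n ≤ 132
  n≤132 = +-cancelˡ-≤ (160 * n) _ _ (begin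
    160 * n + n   ≡⟨ solve (n ∷ []) ⟩
    161 * n       ≤⟨ *-monoˡ-≤ n 161≤n ⟩
    n * n         ≤⟨ n²≤ ⟩
    160 * n + 132 ∎)

lowInNbhd-unique : ∀ {n} → 161 ≤ n → (G : Graph (3 * n + 4)) → ¬ ContainsCopy G (K2 n) →
  ∀ v → (∀ u → degree (complement G) u ≤ degree (complement G) v) →
  ∀ x y → lowInNbhd (complement G) v x ≡ true → lowInNbhd (complement G) v y ≡ true → x ≡ y
lowInNbhd-unique {n} 161≤n G K2-free v maxDegree x y x-low y-low =
  decidable-stable (x ≟ y) λ x≢y → n*n≰160n+132 161≤n
    (n*n≤160n+132 n δ (7n≤4δ+2 n D δ (D-bound x≢y) (m≤n+m∸n N (suc D))) (m∸n≤m N (suc D)) δ*δ≤)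
  where
  N = 3 * n + 4
  Ḡ = complement G
  D = degree Ḡ v
  δ = N ∸ suc D
  low : ∀ {z} → lowInNbhd Ḡ v z ≡ true → 10 * degreeInNbhd Ḡ v z < D + 10
  low {z} z-low = ⌊⌋≡true⇒ (proj₂ (∧≡true {adj Ḡ v z} z-low))
  D-bound : x ≢ y → 4 * D ≤ 5 * n + 14
  D-bound x≢y = 4D≤5n+14 n D (codegree G x y) (degreeInNbhd Ḡ v x) (degreeInNbhd Ḡ v y)
    (degree-complement≤codegree+degreesInNbhd G v x y) (K2-free⇒codegree< G K2-free x≢y)
    (low x-low) (low y-low)
  δ*δ≤ : δ * δ ≤ N + N * n
  δ*δ≤ = ≤-trans (δ*δ≤walks₂ G v (complement-maxDegree⇒minDegree G maxDegree))
    (walks₂≤ G v (λ w w≢v → <⇒≤ (K2-free⇒codegree< G K2-free (w≢v ∘ ≡.sym))))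

lemma3p3 : (m : ℕ) → 7 ≤ m → (Σ ℕ λ t → m ≡ 2 * t + 1) →
    Σ ℕ λ N → (n : ℕ) → 4 * m ≤ n → N ≤ n →
      (G : Graph (3 * n + 4)) →
      ¬ ContainsCopy G (K2 n) →
      ¬ ContainsCopy (complement G) (Wheel m) →
      (v : Fin (3 * n + 4)) →
      ((u : Fin (3 * n + 4)) → degree (complement G) u ≤ degree (complement G) v) →
      lowDegreeCount (complement G) v ≤ 1
lemma3p3 _ _ _ = 161 , λ n _ 161≤n G K2-free _ v maxDegree →
  count≤1 (lowInNbhd (complement G) v) (lowInNbhd-unique 161≤n G K2-free v maxDegree)
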